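{- Let $n$ be a positive multiple of $3$ and $0\le m\le n/3$ an integer, and let $\mathcal{G}(n,m)$ be the $3$-graph defined in the context. Then the number $\varphi(n,m)$ of $4$-element sets $S\subset[n]$ such that $\mathcal{G}(n,m)[S]$ has exactly three edges (induced copies of $K_4^{3- }$) equals $$\varphi(n,m)=\frac{1}{6}m^2(n-3m)(n-3m-3).$$
   Context: Let $[n]=V_1\cup V_2\cup V_3$ be a partition with $|V_j|=n/3$, and for each $j\in[3]$ let $V_j=V_{1,j}\cup V_{2,j}$ be a partition with $|V_{1,j}|=m$ and $|V_{2,j}|=n/3-m$. Indices $j$ are taken modulo $3$. $\mathcal{G}(n,m)$ is the $3$-graph on $[n]$ whose edge set is the union of: (1) $\{abc: a,b,c\in V_{i,j}\}$ for $i\in\{1,2\}$, $j\in[3]$; (2) $\{abc: a,b\in V_{1,j}, c\in V_{2,j}\}$, $j\in[3]$; (3) $\{abc: a,b\in V_{1,j}, c\in V_{j+1}\}$, $j\in[3]$; (4) $\{abc: a,b\in V_{2,j}, c\in V_{1,j+1}\}$, $j\in[3]$; (5) $\{abc: a,b\in V_{2,j}, c\in V_{j-1}\}$, $j\in[3]$; (6) $\{abc: a\in V_{1,j}, b\in V_{2,j}, c\in V_{j+1}\}$, $j\in[3]$. Here $abc$ denotes the set $\{a,b,c\}$ of three distinct vertices. $K_4^{3- }$ is the $3$-graph with four vertices and three edges, and $\mathcal{G}[S]$ denotes the induced subgraph on $S$. -}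

module Defs where

open import Data.Nat using (ℕ; zero; suc; _<ᵇ_)
open import Data.Bool using (Bool; true; false; _∧_; _∨_; if_then_else_)
open import Data.Fin using (Fin; zero; suc; toℕ)
open import Data.List using (List; []; _∷_; length; filter; allFin; concatMap; map)
open import Data.Product using (_×_; _,_)
open import Relation.Nullary.Decidable using (Dec)
open import Relation.Binary.PropositionalEquality using (_≡_)
open import Data.Bool.Properties using (T?)
open import Data.Bool using (T)

-- Level of a vertex: `one` means V_{1,j}, `two` means V_{2,j}.
data Level : Set where
  one two : Level

-- A label (i , j) records that a vertex lies in V_{i,j}; the part j ∈ Fin 3
-- stands for j ∈ {1,2,3} (Fin 3 index 0,1,2 ↔ j = 1,2,3).
Label : Set
Label = Level × Fin 3

next : Fin 3 → Fin 3
next zero = suc zero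
next (suc zero) = suc (suc zero)
next (suc (suc zero)) = zero

prev : Fin 3 → Fin 3
prev zero = suc (suc zero)
prev (suc zero) = zero
prev (suc (suc zero)) = suc zero

_==F_ : {k : ℕ} → Fin k → Fin k → Bool
zero ==F zero = true
suc x ==F suc y = x ==F y
_ ==F _ = false

_==L_ : Level → Level → Bool
one ==L one = true
two ==L two = true
_ ==L _ = false

_==_ : Label → Label → Bool
(i , j) == (i' , j') = (i ==L i') ∧ (j ==F j')

-- Ordered edge pattern: (x , y , z) are the labels of (a , b , c) as in
-- items (1)-(6) of the definition of G(n,m).
pattern3 : Label → Label → Label → Bool
pattern3 (ia , ja) (ib , jb) (ic , jc) =
     -- (1) a,b,c ∈ V_{i,j}
     ((ia ==L ib) ∧ (ib ==L ic) ∧ (ja ==F jb) ∧ (jb ==F jc))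
     -- (2) a,b ∈ V_{1,j}, c ∈ V_{2,j}
  ∨ ((ia ==L one) ∧ (ib ==L one) ∧ (ic ==L two) ∧ (ja ==F jb) ∧ (jc ==F ja))
     -- (3) a,b ∈ V_{1,j}, c ∈ V_{j+1}
  ∨ ((ia ==L one) ∧ (ib ==L one) ∧ (ja ==F jb) ∧ (jc ==F next ja))
     -- (4) a,b ∈ V_{2,j}, c ∈ V_{1,j+1}
  ∨ ((ia ==L two) ∧ (ib ==L two) ∧ (ic ==L one) ∧ (ja ==F jb) ∧ (jc ==F next ja))
     -- (5) a,b ∈ V_{2,j}, c ∈ V_{j-1}
  ∨ ((ia ==L two) ∧ (ib ==L two) ∧ (ja ==F jb) ∧ (jc ==F prev ja))
     -- (6) a ∈ V_{1,j}, b ∈ V_{2,j}, c ∈ V_{j+1}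
  ∨ ((ia ==L one) ∧ (ib ==L two) ∧ (ja ==F jb) ∧ (jc ==F next ja))

isEdge : {n : ℕ} → (Fin n → Label) → Fin n → Fin n → Fin n → Bool
isEdge lab a b c =
  let x = lab a ; y = lab b ; z = lab c in
  pattern3 x y z ∨ pattern3 x z y ∨ pattern3 y x z
  ∨ pattern3 y z x ∨ pattern3 z x y ∨ pattern3 z y x

_<F_ : {n : ℕ} → Fin n → Fin n → Bool
a <F b = toℕ a <ᵇ toℕ b

-- All 4-element subsets of Fin n, each listed once as a < b < c < d.
record Quad (n : ℕ) : Set where
  constructor quad
  field a b c d : Fin n

fourSets : (n : ℕ) → List (Quad n)
fourSets n =
  concatMap (λ a → concatMap (λ b → concatMap (λ c → concatMap (λ d →
    if (a <F b) ∧ (b <F c) ∧ (c <F d) then quad a b c d ∷ [] else [])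
    (allFin n)) (allFin n)) (allFin n)) (allFin n)

b2n : Bool → ℕ
b2n true = 1
b2n false = 0

edgesIn : {n : ℕ} → (Fin n → Label) → Quad n → ℕ
edgesIn lab (quad a b c d) =
  b2n (isEdge lab a b c) Data.Nat.+ b2n (isEdge lab a b d)
  Data.Nat.+ b2n (isEdge lab a c d) Data.Nat.+ b2n (isEdge lab b c d)

φ : (n : ℕ) → (Fin n → Label) → ℕ
φ n lab = length (filter (λ q → T? (edgesIn lab q Data.Nat.≡ᵇ 3)) (fourSets n))

classSize : {n : ℕ} → (Fin n → Label) → Label → ℕ
classSize {n} lab l = length (filter (λ v → T? (lab v == l)) (allFin n))

-- Whether four vertices span an induced K₄³⁻ depends only on their classes V_{i,j}, and a finite
-- check shows that this happens exactly when the classes, counted with multiplicity, are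
-- V_{1,j}, V_{1,j+1}, V_{2,j}, V_{2,j} for some j.  The number of k-subsets of a coloured set
-- with a prescribed number of elements of each colour is a product of binomial coefficients
-- (Pascal's rule, by induction on the list of vertices), so φ(n,m) = 3 · m · m · C(n/3 − m, 2).

module Submission where

open import Defs
open import Data.Nat using (ℕ; zero; suc; _+_; _≤_; _<_; _∸_; _*_; _^_; _/_; _≡ᵇ_; z≤n; s≤s)
open import Data.Nat.Properties
  using (_≟_; suc-injective; +-suc; +-identityʳ; *-distribʳ-+; *-distribˡ-+; *-distribˡ-∸; *-comm; ^-identityʳ;
         m+n≡0⇒m≡0; m+n≡0⇒n≡0; +-0-commutativeMonoid)
open import Data.Nat.DivMod using (m*n/n≡m)
open import Data.Nat.Divisibility using (_∣_; divides)
open import Data.Nat.Combinatorics using (_C_; nC1≡n; nCk+nC[k+1]≡[n+1]C[k+1])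
open import Data.Nat.Tactic.RingSolver using (solve)
open import Algebra.Properties.CommutativeMonoid.Sum +-0-commutativeMonoid
  using (sum-syntax; sum-cong-≗; sum-replicate-zero; ∑-distrib-+)
open import Data.Bool using (Bool; true; false; _∧_; _∨_; if_then_else_)
open import Data.Bool.Properties using (T?) renaming (_≟_ to _≟𝔹_)
open import Data.Fin using (Fin; zero; suc; combine) renaming (_≟_ to _≟F_)
import Data.List as List
open import Data.List using (List; []; _∷_; _++_; length; filter; concatMap; tabulate; allFin)
open import Data.List.Properties using (filter-++; length-++; map-tabulate)
open import Data.List.Membership.Propositional using (_∈_)
open import Data.List.Relation.Unary.Any using (here; there)
open import Data.List.Relation.Unary.All using (All; all?) renaming (lookup to lookupAll)
open import Data.Vec using (Vec; []; _∷_; replicate; updateAt; lookup; sum; toList; map)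
open import Data.Vec.Properties using (≡-dec; ∷-injective; lookup∘updateAt; lookup∘updateAt′; lookup-replicate)
open import Data.Product using (_,_; ∃-syntax; proj₂)
open import Data.Sum using (_⊎_; inj₁; inj₂)
open import Function using (_∘_)
open import Relation.Nullary using (Dec; yes; no; does)
open import Relation.Nullary.Decidable using (dec-true; dec-false; toWitness)
open import Relation.Binary.PropositionalEquality using (_≡_; _≢_; refl; cong; cong₂; sym; trans; subst)
open Relation.Binary.PropositionalEquality.≡-Reasoning

-- Sums over k-element sublists

sumSublists : {A : Set} (k : ℕ) → (Vec A k → ℕ) → List A → ℕ
sumSublists zero    f _        = f []
sumSublists (suc k) f []       = 0
sumSublists (suc k) f (x ∷ xs) = sumSublists k (f ∘ (x ∷_)) xs + sumSublists (suc k) f xs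

sumSublists-cong : {A : Set} (k : ℕ) {f g : Vec A k → ℕ} → (∀ v → f v ≡ g v) → ∀ xs →
  sumSublists k f xs ≡ sumSublists k g xs
sumSublists-cong zero    f≗g _        = f≗g []
sumSublists-cong (suc k) f≗g []       = refl
sumSublists-cong (suc k) f≗g (x ∷ xs) =
  cong₂ _+_ (sumSublists-cong k (f≗g ∘ (x ∷_)) xs) (sumSublists-cong (suc k) f≗g xs)

sumSublists-zero : {A : Set} (k : ℕ) (xs : List A) → sumSublists k (λ _ → 0) xs ≡ 0
sumSublists-zero zero    _        = refl
sumSublists-zero (suc k) []       = refl
sumSublists-zero (suc k) (x ∷ xs) = cong₂ _+_ (sumSublists-zero k xs) (sumSublists-zero (suc k) xs)

sumSublists-map : {A B : Set} (k : ℕ) (f : Vec B k → ℕ) (g : A → B) (xs : List A) →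
  sumSublists k (f ∘ map g) xs ≡ sumSublists k f (List.map g xs)
sumSublists-map zero    f g _        = refl
sumSublists-map (suc k) f g []       = refl
sumSublists-map (suc k) f g (x ∷ xs) =
  cong₂ _+_ (sumSublists-map k (f ∘ (g x ∷_)) g xs) (sumSublists-map (suc k) f g xs)

sumSublists-∑ : {A : Set} {r : ℕ} (k : ℕ) (f : Fin r → Vec A k → ℕ) (xs : List A) →
  sumSublists k (λ v → ∑[ j < r ] f j v) xs ≡ ∑[ j < r ] sumSublists k (f j) xs
sumSublists-∑         zero    f _        = refl
sumSublists-∑ {r = r} (suc k) f []       = sym (sum-replicate-zero r)
sumSublists-∑         (suc k) f (x ∷ xs) =
  trans (cong₂ _+_ (sumSublists-∑ k (λ j → f j ∘ (x ∷_)) xs) (sumSublists-∑ (suc k) f xs))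
        (sym (∑-distrib-+ (λ j → sumSublists k (f j ∘ (x ∷_)) xs) (λ j → sumSublists (suc k) (f j) xs)))

-- Counting sublists by their histogram

sum-updateAt-suc : {r : ℕ} (M : Vec ℕ r) (x : Fin r) → sum (updateAt M x suc) ≡ suc (sum M)
sum-updateAt-suc (a ∷ M) zero    = refl
sum-updateAt-suc (a ∷ M) (suc x) = trans (cong (a +_) (sum-updateAt-suc M x)) (+-suc a (sum M))

sum≡0⇒≡replicate : {r : ℕ} (M : Vec ℕ r) → sum M ≡ 0 → M ≡ replicate r 0
sum≡0⇒≡replicate []      _    = refl
sum≡0⇒≡replicate (a ∷ M) ΣM≡0 =
  cong₂ _∷_ (m+n≡0⇒m≡0 a ΣM≡0) (sum≡0⇒≡replicate M (m+n≡0⇒n≡0 a ΣM≡0))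

lookup≡0⊎≡updateAt-suc : {r : ℕ} (M : Vec ℕ r) (x : Fin r) →
  lookup M x ≡ 0 ⊎ ∃[ M′ ] M ≡ updateAt M′ x suc
lookup≡0⊎≡updateAt-suc (zero  ∷ M) zero    = inj₁ refl
lookup≡0⊎≡updateAt-suc (suc a ∷ M) zero    = inj₂ (a ∷ M , refl)
lookup≡0⊎≡updateAt-suc (a ∷ M)     (suc x) with lookup≡0⊎≡updateAt-suc M x
... | inj₁ M[x]≡0      = inj₁ M[x]≡0
... | inj₂ (M′ , refl) = inj₂ (a ∷ M′ , refl)

updateAt-suc-injective : {r : ℕ} (c M : Vec ℕ r) (x : Fin r) → updateAt c x suc ≡ updateAt M x suc → c ≡ M
updateAt-suc-injective (c ∷ cs) (a ∷ M) zero    refl = refl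
updateAt-suc-injective (c ∷ cs) (a ∷ M) (suc x) eq with ∷-injective eq
... | refl , eq′ = cong (c ∷_) (updateAt-suc-injective cs M x eq′)

updateAt-suc≢ : {r : ℕ} (c M : Vec ℕ r) (x : Fin r) → lookup M x ≡ 0 → updateAt c x suc ≢ M
updateAt-suc≢ (c ∷ cs) (zero ∷ M) zero    _      ()
updateAt-suc≢ (c ∷ cs) (a ∷ M)    (suc x) M[x]≡0 eq = updateAt-suc≢ cs M x M[x]≡0 (proj₂ (∷-injective eq))

lookup-updateAt-suc : {r : ℕ} (c : Vec ℕ r) (x y : Fin r) →
  lookup (updateAt c x suc) y ≡ b2n (does (x ≟F y)) + lookup c y
lookup-updateAt-suc c x y with x ≟F y
... | yes refl = lookup∘updateAt x c
... | no  x≢y  = lookup∘updateAt′ y x (x≢y ∘ sym) c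

∏C : {r : ℕ} → Vec ℕ r → Vec ℕ r → ℕ
∏C []       []      = 1
∏C (c ∷ cs) (a ∷ M) = (c C a) * ∏C cs M

∏C-pascal : {r : ℕ} (c M : Vec ℕ r) (x : Fin r) →
  ∏C (updateAt c x suc) (updateAt M x suc) ≡ ∏C c M + ∏C c (updateAt M x suc)
∏C-pascal (c ∷ cs) (a ∷ M) zero = begin
  (suc c C suc a) * ∏C cs M                ≡⟨ cong (_* ∏C cs M) (sym (nCk+nC[k+1]≡[n+1]C[k+1] c a)) ⟩
  (c C a + c C suc a) * ∏C cs M            ≡⟨ *-distribʳ-+ (∏C cs M) (c C a) (c C suc a) ⟩
  (c C a) * ∏C cs M + (c C suc a) * ∏C cs M ∎
∏C-pascal (c ∷ cs) (a ∷ M) (suc x) = begin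
  (c C a) * ∏C (updateAt cs x suc) (updateAt M x suc)   ≡⟨ cong ((c C a) *_) (∏C-pascal cs M x) ⟩
  (c C a) * (∏C cs M + ∏C cs (updateAt M x suc))        ≡⟨ *-distribˡ-+ (c C a) (∏C cs M) _ ⟩
  (c C a) * ∏C cs M + (c C a) * ∏C cs (updateAt M x suc) ∎

∏C-updateAt-suc : {r : ℕ} (c M : Vec ℕ r) (x : Fin r) → lookup M x ≡ 0 → ∏C (updateAt c x suc) M ≡ ∏C c M
∏C-updateAt-suc (c ∷ cs) (zero ∷ M) zero    refl   = refl
∏C-updateAt-suc (c ∷ cs) (a ∷ M)    (suc x) M[x]≡0 = cong ((c C a) *_) (∏C-updateAt-suc cs M x M[x]≡0)

∏C-replicate-0ʳ : {r : ℕ} (c : Vec ℕ r) → ∏C c (replicate r 0) ≡ 1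
∏C-replicate-0ʳ []       = refl
∏C-replicate-0ʳ (c ∷ cs) = trans (+-identityʳ _) (∏C-replicate-0ʳ cs)

∏C-replicate-0ˡ : {r : ℕ} (M : Vec ℕ r) → 0 < sum M → ∏C (replicate r 0) M ≡ 0
∏C-replicate-0ˡ (zero  ∷ M) 0<ΣM = trans (+-identityʳ _) (∏C-replicate-0ˡ M 0<ΣM)
∏C-replicate-0ˡ (suc a ∷ M) _    = refl

histogram : {r : ℕ} → List (Fin r) → Vec ℕ r
histogram []       = replicate _ 0
histogram (x ∷ xs) = updateAt (histogram xs) x suc

_≟ᵥ_ : {r : ℕ} (c M : Vec ℕ r) → Dec (c ≡ M)
_≟ᵥ_ = ≡-dec _≟_

hasHistogram : {r k : ℕ} → Vec ℕ r → Vec (Fin r) k → ℕ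
hasHistogram M v = b2n (does (histogram (toList v) ≟ᵥ M))

hasHistogram-∷ : {r k : ℕ} (M : Vec ℕ r) (x : Fin r) (v : Vec (Fin r) k) →
  hasHistogram (updateAt M x suc) (x ∷ v) ≡ hasHistogram M v
hasHistogram-∷ M x v with histogram (toList v) ≟ᵥ M
... | yes refl = cong b2n (dec-true (updateAt M x suc ≟ᵥ updateAt M x suc) refl)
... | no  h≢M  = cong b2n (dec-false (updateAt (histogram (toList v)) x suc ≟ᵥ updateAt M x suc)
                                     (h≢M ∘ updateAt-suc-injective _ M x))

sumSublists-hasHistogram : {r : ℕ} (k : ℕ) (M : Vec ℕ r) → sum M ≡ k → (xs : List (Fin r)) →
  sumSublists k (hasHistogram M) xs ≡ ∏C (histogram xs) M
sumSublists-hasHistogram {r} zero M ΣM≡0 xs rewrite sum≡0⇒≡replicate M ΣM≡0 = begin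
  b2n (does (replicate r 0 ≟ᵥ replicate r 0)) ≡⟨ cong b2n (dec-true (replicate r 0 ≟ᵥ replicate r 0) refl) ⟩
  1                                           ≡⟨ sym (∏C-replicate-0ʳ (histogram xs)) ⟩
  ∏C (histogram xs) (replicate r 0)           ∎
sumSublists-hasHistogram (suc k) M ΣM≡1+k [] =
  sym (∏C-replicate-0ˡ M (subst (0 <_) (sym ΣM≡1+k) (s≤s z≤n)))
sumSublists-hasHistogram (suc k) M ΣM≡1+k (x ∷ xs) with lookup≡0⊎≡updateAt-suc M x
... | inj₁ M[x]≡0 = begin
  sumSublists k (hasHistogram M ∘ (x ∷_)) xs + sumSublists (suc k) (hasHistogram M) xs
    ≡⟨ cong₂ _+_ (trans (sumSublists-cong k x∷v≢M xs) (sumSublists-zero k xs))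
                 (sumSublists-hasHistogram (suc k) M ΣM≡1+k xs) ⟩
  ∏C (histogram xs) M
    ≡⟨ sym (∏C-updateAt-suc (histogram xs) M x M[x]≡0) ⟩
  ∏C (updateAt (histogram xs) x suc) M ∎
  where
  x∷v≢M : ∀ v → hasHistogram M (x ∷ v) ≡ 0
  x∷v≢M v = cong b2n (dec-false (updateAt (histogram (toList v)) x suc ≟ᵥ M)
                                (updateAt-suc≢ (histogram (toList v)) M x M[x]≡0))
... | inj₂ (M′ , refl) = begin
  sumSublists k (hasHistogram (updateAt M′ x suc) ∘ (x ∷_)) xs + sumSublists (suc k) (hasHistogram (updateAt M′ x suc)) xs
    ≡⟨ cong₂ _+_ (trans (sumSublists-cong k (hasHistogram-∷ M′ x) xs) (sumSublists-hasHistogram k M′ ΣM′≡k xs))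
                 (sumSublists-hasHistogram (suc k) _ ΣM≡1+k xs) ⟩
  ∏C (histogram xs) M′ + ∏C (histogram xs) (updateAt M′ x suc)
    ≡⟨ sym (∏C-pascal (histogram xs) M′ x) ⟩
  ∏C (updateAt (histogram xs) x suc) (updateAt M′ x suc) ∎
  where
  ΣM′≡k : sum M′ ≡ k
  ΣM′≡k = suc-injective (trans (sym (sum-updateAt-suc M′ x)) ΣM≡1+k)

sum-histogram : {r : ℕ} (xs : List (Fin r)) → sum (histogram xs) ≡ length xs
sum-histogram {zero}  [] = refl
sum-histogram {suc r} [] = sum-histogram {r} []
sum-histogram (x ∷ xs) = trans (sum-updateAt-suc (histogram xs) x) (cong suc (sum-histogram xs))

-- 4-subsets of Fin n as ascending index tuples

count : {B : Set} → (B → Bool) → List B → ℕ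
count P xs = length (filter (T? ∘ P) xs)

count-∷ : {B : Set} (P : B → Bool) (x : B) (xs : List B) → count P (x ∷ xs) ≡ b2n (P x) + count P xs
count-∷ P x xs with P x
... | true  = refl
... | false = refl

count-++ : {B : Set} (P : B → Bool) (xs ys : List B) → count P (xs ++ ys) ≡ count P xs + count P ys
count-++ P xs ys = trans (cong length (filter-++ (T? ∘ P) xs ys)) (length-++ (filter (T? ∘ P) xs))

count-concatMap-tabulate : {B : Set} {m n : ℕ} (P : B → Bool) (f : Fin m → List B) (g : Fin n → Fin m) →
  count P (concatMap f (tabulate g)) ≡ ∑[ i < n ] count P (f (g i))
count-concatMap-tabulate {n = zero}  P f g = refl
count-concatMap-tabulate {n = suc n} P f g =
  trans (count-++ P (f (g zero)) _) (cong (count P (f (g zero)) +_) (count-concatMap-tabulate P f (g ∘ suc)))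

count-concatMap : {B : Set} {n : ℕ} (P : B → Bool) (f : Fin n → List B) →
  count P (concatMap f (allFin n)) ≡ ∑[ i < n ] count P (f i)
count-concatMap P f = count-concatMap-tabulate P f (λ i → i)

sumAscending : {A : Set} {n : ℕ} (k : ℕ) → (Fin n → Bool) → (Fin n → A) → (Vec A k → ℕ) → ℕ
sumAscending         zero    first lab f = f []
sumAscending {n = n} (suc k) first lab f =
  ∑[ a < n ] (if first a then sumAscending k (a <F_) lab (f ∘ (lab a ∷_)) else 0)

sumAscending-suc : {A : Set} {n : ℕ} (k : ℕ) (first : Fin (suc n) → Bool) (lab : Fin (suc n) → A) (f : Vec A k → ℕ) →
  first zero ≡ false → sumAscending k first lab f ≡ sumAscending k (first ∘ suc) (lab ∘ suc) f
sumAscending-suc zero    first lab f _ = refl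
sumAscending-suc (suc k) first lab f first0≡false rewrite first0≡false =
  sum-cong-≗ λ a → cong (λ t → if first (suc a) then t else 0)
    (sumAscending-suc k (suc a <F_) lab (f ∘ (lab (suc a) ∷_)) refl)

sumAscending≡sumSublists : {A : Set} {n : ℕ} (k : ℕ) (lab : Fin n → A) (f : Vec A k → ℕ) →
  sumAscending k (λ _ → true) lab f ≡ sumSublists k f (tabulate lab)
sumAscending≡sumSublists             zero    lab f = refl
sumAscending≡sumSublists {n = zero}  (suc k) lab f = refl
sumAscending≡sumSublists {n = suc n} (suc k) lab f = cong₂ _+_
  (trans (sumAscending-suc k (zero <F_) lab (f ∘ (lab zero ∷_)) refl)
         (sumAscending≡sumSublists k (lab ∘ suc) (f ∘ (lab zero ∷_))))
  (trans (sum-cong-≗ λ a → sumAscending-suc k (suc a <F_) lab (f ∘ (lab (suc a) ∷_)) refl)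
         (sumAscending≡sumSublists (suc k) (lab ∘ suc) f))

edge : Label → Label → Label → Bool
edge x y z = pattern3 x y z ∨ pattern3 x z y ∨ pattern3 y x z ∨ pattern3 y z x ∨ pattern3 z x y ∨ pattern3 z y x

inducedK4⁻ : Vec Label 4 → ℕ
inducedK4⁻ (x ∷ y ∷ z ∷ w ∷ []) =
  b2n (b2n (edge x y z) + b2n (edge x y w) + b2n (edge x z w) + b2n (edge y z w) ≡ᵇ 3)

φ≡sumAscending : (n : ℕ) (lab : Fin n → Label) → φ n lab ≡ sumAscending 4 (λ _ → true) lab inducedK4⁻
φ≡sumAscending n lab =
  trans (count-concatMap P quads₁) (sum-cong-≗ λ a → trans (count-concatMap P (quads₂ a)) (sum-cong-≗ λ b →
    trans (count-concatMap P (quads₃ a b)) (trans (sum-cong-≗ λ c → count-concatMap P (quads₄ a b c)) (guard₁ a b))))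
  where
  P : Quad n → Bool
  P q = edgesIn lab q ≡ᵇ 3
  quads₄ : Fin n → Fin n → Fin n → Fin n → List (Quad n)
  quads₄ a b c d = if (a <F b) ∧ (b <F c) ∧ (c <F d) then quad a b c d ∷ [] else []
  quads₃ : Fin n → Fin n → Fin n → List (Quad n)
  quads₃ a b c = concatMap (quads₄ a b c) (allFin n)
  quads₂ : Fin n → Fin n → List (Quad n)
  quads₂ a b = concatMap (quads₃ a b) (allFin n)
  quads₁ : Fin n → List (Quad n)
  quads₁ a = concatMap (quads₂ a) (allFin n)
  w : Fin n → Fin n → Fin n → Fin n → ℕ
  w a b c d = inducedK4⁻ (lab a ∷ lab b ∷ lab c ∷ lab d ∷ [])
  guard₃ : ∀ a b c d → count P (if c <F d then quad a b c d ∷ [] else []) ≡ (if c <F d then w a b c d else 0)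
  guard₃ a b c d with c <F d
  ... | false = refl
  ... | true  = trans (count-∷ P (quad a b c d) []) (+-identityʳ _)
  guard₂ : ∀ a b c → ∑[ d < n ] count P (if (b <F c) ∧ (c <F d) then quad a b c d ∷ [] else [])
                   ≡ (if b <F c then ∑[ d < n ] (if c <F d then w a b c d else 0) else 0)
  guard₂ a b c with b <F c
  ... | false = sum-replicate-zero n
  ... | true  = sum-cong-≗ (guard₃ a b c)
  guard₁ : ∀ a b → ∑[ c < n ] ∑[ d < n ] count P (quads₄ a b c d)
                 ≡ (if a <F b then ∑[ c < n ] (if b <F c then ∑[ d < n ] (if c <F d then w a b c d else 0) else 0) else 0)
  guard₁ a b with a <F b
  ... | false = trans (sum-cong-≗ {n} (λ _ → sum-replicate-zero n)) (sum-replicate-zero n)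
  ... | true  = sum-cong-≗ (guard₂ a b)

-- Histograms of labels are indexed by code, in the order V₁,₁ V₁,₂ V₁,₃ V₂,₁ V₂,₂ V₂,₃.
code : Label → Fin 6
code (i , j) = combine (level i) j
  where
  level : Level → Fin 2
  level one = zero
  level two = suc zero

labels : List Label
labels = (one , zero) ∷ (one , suc zero) ∷ (one , suc (suc zero))
       ∷ (two , zero) ∷ (two , suc zero) ∷ (two , suc (suc zero)) ∷ []

∈-labels : (x : Label) → x ∈ labels
∈-labels (one , zero)           = here refl
∈-labels (one , suc zero)       = there (here refl)
∈-labels (one , suc (suc zero)) = there (there (here refl))
∈-labels (two , zero)           = there (there (there (here refl)))
∈-labels (two , suc zero)       = there (there (there (there (here refl))))
∈-labels (two , suc (suc zero)) = there (there (there (there (there (here refl)))))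

∀-labels : {P : Label → Set} → All P labels → ∀ x → P x
∀-labels ps x = lookupAll ps (∈-labels x)

==-code : (x y : Label) → (x == y) ≡ does (code x ≟F code y)
==-code x y = ∀-labels (∀-labels table x) y
  where
  table : All (λ x → All (λ y → (x == y) ≡ does (code x ≟F code y)) labels) labels
  table = toWitness {a? = all? (λ x → all? (λ y → (x == y) ≟𝔹 does (code x ≟F code y)) labels) labels} _

K4⁻histogram : Fin 3 → Vec ℕ 6
K4⁻histogram j = histogram (List.map code ((one , j) ∷ (one , next j) ∷ (two , j) ∷ (two , j) ∷ []))

sum-K4⁻histogram : (j : Fin 3) → sum (K4⁻histogram j) ≡ 4
sum-K4⁻histogram j = sum-histogram (List.map code ((one , j) ∷ (one , next j) ∷ (two , j) ∷ (two , j) ∷ []))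

-- Both sides are evaluated on all 6⁴ label quadruples.
inducedK4⁻-histograms : (v : Vec Label 4) → inducedK4⁻ v ≡ ∑[ j < 3 ] hasHistogram (K4⁻histogram j) (map code v)
inducedK4⁻-histograms (x ∷ y ∷ z ∷ w ∷ []) = ∀-labels (∀-labels (∀-labels (∀-labels table x) y) z) w
  where
  Claim : Label → Label → Label → Label → Set
  Claim x y z w =
    inducedK4⁻ (x ∷ y ∷ z ∷ w ∷ []) ≡ ∑[ j < 3 ] hasHistogram (K4⁻histogram j) (map code (x ∷ y ∷ z ∷ w ∷ []))
  claim? : ∀ x y z w → Dec (Claim x y z w)
  claim? x y z w = _ ≟ _
  table : All (λ x → All (λ y → All (λ z → All (Claim x y z) labels) labels) labels) labels
  table = toWitness {a? = all? (λ x → all? (λ y → all? (λ z → all? (claim? x y z) labels) labels) labels) labels} _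

lookup-histogram : {B : Set} (lab : B → Label) (is : List B) (l : Label) →
  lookup (histogram (List.map (code ∘ lab) is)) (code l) ≡ count (λ i → lab i == l) is
lookup-histogram lab []       l = lookup-replicate (code l) 0
lookup-histogram lab (i ∷ is) l = begin
  lookup (updateAt (histogram (List.map (code ∘ lab) is)) (code (lab i)) suc) (code l)
    ≡⟨ lookup-updateAt-suc (histogram (List.map (code ∘ lab) is)) (code (lab i)) (code l) ⟩
  b2n (does (code (lab i) ≟F code l)) + lookup (histogram (List.map (code ∘ lab) is)) (code l)
    ≡⟨ cong₂ _+_ (cong b2n (sym (==-code (lab i) l))) (lookup-histogram lab is l) ⟩
  b2n (lab i == l) + count (λ i → lab i == l) is
    ≡⟨ sym (count-∷ (λ i → lab i == l) i is) ⟩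
  count (λ i → lab i == l) (i ∷ is) ∎

classSizes : {n : ℕ} → (Fin n → Label) → Vec ℕ 6
classSizes lab = histogram (List.map code (tabulate lab))

lookup-classSizes : {n : ℕ} (lab : Fin n → Label) (l : Label) → lookup (classSizes lab) (code l) ≡ classSize lab l
lookup-classSizes {n} lab l = begin
  lookup (histogram (List.map code (tabulate lab))) (code l)
    ≡⟨ cong (λ xs → lookup (histogram xs) (code l))
            (trans (map-tabulate lab code) (sym (map-tabulate (λ i → i) (code ∘ lab)))) ⟩
  lookup (histogram (List.map (code ∘ lab) (allFin n))) (code l)
    ≡⟨ lookup-histogram lab (allFin n) l ⟩
  classSize lab l ∎

≡-by-levels : {m s : ℕ} (c : Vec ℕ 6) →
  (∀ j → lookup c (code (one , j)) ≡ m) → (∀ j → lookup c (code (two , j)) ≡ s) → c ≡ m ∷ m ∷ m ∷ s ∷ s ∷ s ∷ []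
≡-by-levels (_ ∷ _ ∷ _ ∷ _ ∷ _ ∷ _ ∷ []) ≡m ≡s
  with ≡m zero | ≡m (suc zero) | ≡m (suc (suc zero)) | ≡s zero | ≡s (suc zero) | ≡s (suc (suc zero))
... | refl | refl | refl | refl | refl | refl = refl

φ≡∑∏C : (n : ℕ) (lab : Fin n → Label) → φ n lab ≡ ∑[ j < 3 ] ∏C (classSizes lab) (K4⁻histogram j)
φ≡∑∏C n lab = begin
  φ n lab
    ≡⟨ φ≡sumAscending n lab ⟩
  sumAscending 4 (λ _ → true) lab inducedK4⁻
    ≡⟨ sumAscending≡sumSublists 4 lab inducedK4⁻ ⟩
  sumSublists 4 inducedK4⁻ (tabulate lab)
    ≡⟨ sumSublists-cong 4 inducedK4⁻-histograms (tabulate lab) ⟩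
  sumSublists 4 (λ v → ∑[ j < 3 ] hasHistogram (K4⁻histogram j) (map code v)) (tabulate lab)
    ≡⟨ sumSublists-∑ 4 (λ j → hasHistogram (K4⁻histogram j) ∘ map code) (tabulate lab) ⟩
  ∑[ j < 3 ] sumSublists 4 (hasHistogram (K4⁻histogram j) ∘ map code) (tabulate lab)
    ≡⟨ sum-cong-≗ (λ j → trans (sumSublists-map 4 (hasHistogram (K4⁻histogram j)) code (tabulate lab))
                               (sumSublists-hasHistogram 4 (K4⁻histogram j) (sum-K4⁻histogram j) colours)) ⟩
  ∑[ j < 3 ] ∏C (classSizes lab) (K4⁻histogram j) ∎
  where
  colours : List (Fin 6)
  colours = List.map code (tabulate lab)

-- The binomial coefficients are abstracted so that the ring solver sees variables.
∑∏C-uniform : (m s : ℕ) →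
  ∑[ j < 3 ] ∏C (m ∷ m ∷ m ∷ s ∷ s ∷ s ∷ []) (K4⁻histogram j) ≡ 3 * (m * m * (s C 2))
∑∏C-uniform m s with m C 1 | nC1≡n m | s C 2
... | _ | refl | c = solve (m List.∷ c List.∷ List.[])

2*nC2≡n*[n∸1] : (n : ℕ) → 2 * (n C 2) ≡ n * (n ∸ 1)
2*nC2≡n*[n∸1] zero          = refl
2*nC2≡n*[n∸1] (suc zero)    = refl
2*nC2≡n*[n∸1] (suc (suc n)) = begin
  2 * (suc (suc n) C 2)             ≡⟨ cong (2 *_) (sym (nCk+nC[k+1]≡[n+1]C[k+1] (suc n) 1)) ⟩
  2 * (suc n C 1 + suc n C 2)       ≡⟨ cong (λ a → 2 * (a + suc n C 2)) (nC1≡n (suc n)) ⟩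
  2 * (suc n + suc n C 2)           ≡⟨ *-distribˡ-+ 2 (suc n) _ ⟩
  2 * suc n + 2 * (suc n C 2)       ≡⟨ cong (2 * suc n +_) (2*nC2≡n*[n∸1] (suc n)) ⟩
  2 * suc n + suc n * n             ≡⟨ solve (n List.∷ List.[]) ⟩
  suc (suc n) * suc n               ∎

3m²C[s,2]≡ : (m s : ℕ) → 3 * (m * m * (s C 2)) ≡ (m ^ 2 * (3 * s) * (3 * s ∸ 3)) / 6
3m²C[s,2]≡ m s = sym (begin
  (m ^ 2 * (3 * s) * (3 * s ∸ 3)) / 6
    ≡⟨ cong₂ (λ a t → (a * (3 * s) * t) / 6) (cong (m *_) (^-identityʳ m)) (sym (*-distribˡ-∸ 3 s 1)) ⟩
  (m * m * (3 * s) * (3 * (s ∸ 1))) / 6   ≡⟨ cong (_/ 6) (scale m s (s ∸ 1) (s C 2) (2*nC2≡n*[n∸1] s)) ⟩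
  (3 * (m * m * (s C 2)) * 6) / 6         ≡⟨ m*n/n≡m _ 6 ⟩
  3 * (m * m * (s C 2))                   ∎)
  where
  scale : ∀ m s t c → 2 * c ≡ s * t → m * m * (3 * s) * (3 * t) ≡ 3 * (m * m * c) * 6
  scale m s t c 2c≡st = begin
    m * m * (3 * s) * (3 * t)  ≡⟨ solve (m List.∷ s List.∷ t List.∷ List.[]) ⟩
    9 * (m * m) * (s * t)      ≡⟨ cong (9 * (m * m) *_) (sym 2c≡st) ⟩
    9 * (m * m) * (2 * c)      ≡⟨ solve (m List.∷ c List.∷ List.[]) ⟩
    3 * (m * m * c) * 6        ∎

n∸3m≡3[n/3∸m] : ∀ {n} m → 3 ∣ n → n ∸ 3 * m ≡ 3 * (n / 3 ∸ m)
n∸3m≡3[n/3∸m] {n} m (divides q n≡q*3) = begin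
  n ∸ 3 * m        ≡⟨ cong (_∸ 3 * m) (trans n≡q*3 (*-comm q 3)) ⟩
  3 * q ∸ 3 * m    ≡⟨ *-distribˡ-∸ 3 q m ⟨
  3 * (q ∸ m)      ≡⟨ cong (λ t → 3 * (t ∸ m)) (trans (cong (_/ 3) n≡q*3) (m*n/n≡m q 3)) ⟨
  3 * (n / 3 ∸ m)  ∎

lemma2p1 : (n m : ℕ) → 0 < n → 3 ∣ n → m ≤ n / 3
    → (lab : Fin n → Label)
    → (∀ j → classSize lab (one , j) ≡ m)
    → (∀ j → classSize lab (two , j) ≡ n / 3 ∸ m)
    → φ n lab ≡ (m ^ 2 * (n ∸ 3 * m) * (n ∸ 3 * m ∸ 3)) / 6
lemma2p1 n m _ 3∣n _ lab |V₁ⱼ|≡m |V₂ⱼ|≡s = begin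
  φ n lab
    ≡⟨ φ≡∑∏C n lab ⟩
  ∑[ j < 3 ] ∏C (classSizes lab) (K4⁻histogram j)
    ≡⟨ cong (λ c → ∑[ j < 3 ] ∏C c (K4⁻histogram j)) sizes ⟩
  ∑[ j < 3 ] ∏C (m ∷ m ∷ m ∷ s ∷ s ∷ s ∷ []) (K4⁻histogram j)
    ≡⟨ ∑∏C-uniform m s ⟩
  3 * (m * m * (s C 2))
    ≡⟨ 3m²C[s,2]≡ m s ⟩
  (m ^ 2 * (3 * s) * (3 * s ∸ 3)) / 6
    ≡⟨ cong (λ t → (m ^ 2 * t * (t ∸ 3)) / 6) (n∸3m≡3[n/3∸m] m 3∣n) ⟨
  (m ^ 2 * (n ∸ 3 * m) * (n ∸ 3 * m ∸ 3)) / 6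
    ∎
  where
  s : ℕ
  s = n / 3 ∸ m
  sizes : classSizes lab ≡ m ∷ m ∷ m ∷ s ∷ s ∷ s ∷ []
  sizes = ≡-by-levels (classSizes lab) (λ j → trans (lookup-classSizes lab (one , j)) (|V₁ⱼ|≡m j))
                                        (λ j → trans (lookup-classSizes lab (two , j)) (|V₂ⱼ|≡s j))
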